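{- In the Zeckendorf Game, for a state given by the multiset $\{F_{k_1},\dots,F_{k_m}\}$ define $S=\sum_{j=1}^m \sqrt{k_j}$ (the sum of the square roots of the indices of the terms). Then $S$ is a monovariant: along any sequence of legal moves, $S$ changes monotonically (it is non-increasing or non-decreasing).
   Context: Fibonacci numbers are indexed as $F_1=1$, $F_2=2$, $F_{i+1}=F_i+F_{i-1}$. The Zeckendorf Game on $n$: the state is an unordered multiset of Fibonacci numbers summing to $n$, initially $n$ copies of $F_1$; a legal move is one of: (1) replace $F_{i-1},F_i$ by $F_{i+1}$; (2a) replace $F_1,F_1$ by $F_2$; (2b) replace $F_2,F_2$ by $F_1,F_3$; (2c) for $i\ge3$, replace $F_i,F_i$ by $F_{i-2},F_{i+1}$. A monovariant is a quantity which is either non-increasing or non-decreasing. -}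

module Defs where

open import Level using (Level; _⊔_) renaming (suc to lsuc)
open import Data.Nat using (ℕ; zero; suc; _<_)
open import Data.List using (List; []; _∷_; _++_; replicate)
open import Data.List.Relation.Binary.Permutation.Propositional using (_↭_)
open import Data.Product using (∃)
open import Data.Sum using (_⊎_)
open import Relation.Nullary using (¬_)
open import Relation.Binary.Structures using (IsTotalOrder)
open import Relation.Binary.PropositionalEquality using (_≡_)
open import Algebra.Bundles using (CommutativeRing)

-- Fibonacci numbers are identified with their indices: the summand F_i
-- is recorded as the natural number i (i ≥ 1).  A state of the game is
-- an unordered multiset of indices, represented by a list taken up to
-- permutation (all moves below are invariant under _↭_).

-- Legal moves (on indices):
--  (1)  F_{i-1}, F_i  ↦ F_{i+1}         (i ≥ 2): indices (suc k, suc (suc k)) ↦ suc (suc (suc k))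
--  (2a) F_1, F_1      ↦ F_2
--  (2b) F_2, F_2      ↦ F_1, F_3
--  (2c) F_i, F_i      ↦ F_{i-2}, F_{i+1}  (i ≥ 3): i = suc (suc (suc k)) ↦ suc k, suc(suc(suc(suc k)))
data LocalMove : List ℕ → List ℕ → Set where
  combine : ∀ k → LocalMove (suc k ∷ suc (suc k) ∷ []) (suc (suc (suc k)) ∷ [])
  ones    : LocalMove (1 ∷ 1 ∷ []) (2 ∷ [])
  twos    : LocalMove (2 ∷ 2 ∷ []) (1 ∷ 3 ∷ [])
  split   : ∀ k → LocalMove (suc (suc (suc k)) ∷ suc (suc (suc k)) ∷ [])
                            (suc k ∷ suc (suc (suc (suc k))) ∷ [])

record Move (xs ys : List ℕ) : Set where
  constructor move
  field
    old new rest : List ℕ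
    local : LocalMove old new
    xs≈   : xs ↭ (old ++ rest)
    ys≈   : ys ↭ (new ++ rest)

initial : ℕ → List ℕ
initial n = replicate n 1

-- The agda standard library has no real numbers.  We therefore work in
-- an arbitrary ordered field in which nonnegative elements have square
-- roots (a Euclidean field; ℝ is one).

record OrderedSqrtField c ℓ₁ ℓ₂ : Set (lsuc (c ⊔ ℓ₁ ⊔ ℓ₂)) where
  field
    commutativeRing : CommutativeRing c ℓ₁
  open CommutativeRing commutativeRing public
  field
    _≤_          : Carrier → Carrier → Set ℓ₂
    isTotalOrder : IsTotalOrder _≈_ _≤_
    +-monoʳ-≤    : ∀ {x y} z → x ≤ y → (x + z) ≤ (y + z)
    *-nonneg     : ∀ {x y} → 0# ≤ x → 0# ≤ y → 0# ≤ (x * y)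
    0≉1          : ¬ (0# ≈ 1#)
    inverse      : ∀ x → ¬ (x ≈ 0#) → ∃ λ y → (x * y) ≈ 1#
    √            : Carrier → Carrier
    √-nonneg     : ∀ {x} → 0# ≤ x → 0# ≤ √ x
    √-square     : ∀ {x} → 0# ≤ x → (√ x * √ x) ≈ x

module _ {c ℓ₁ ℓ₂} (R : OrderedSqrtField c ℓ₁ ℓ₂) where
  open OrderedSqrtField R

  ι : ℕ → Carrier
  ι zero    = 0#
  ι (suc n) = 1# + ι n

  S : List ℕ → Carrier
  S []       = 0#
  S (k ∷ ks) = √ (ι k) + S ks

  NonIncreasing : (len : ℕ) → (ℕ → List ℕ) → Set ℓ₂
  NonIncreasing len st = ∀ i → i < len → S (st (suc i)) ≤ S (st i)

  NonDecreasing : (len : ℕ) → (ℕ → List ℕ) → Set ℓ₂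
  NonDecreasing len st = ∀ i → i < len → S (st i) ≤ S (st (suc i))

record Play (n len : ℕ) (st : ℕ → List ℕ) : Set where
  field
    start : st 0 ≡ initial n
    legal : ∀ i → i < len → Move (st i) (st (suc i))

module Submission where

-- Every move replaces two summands by one or two summands, and the
-- indices obey one of two inequalities:
--   * merging  F_a, F_b ↦ F_c     (moves 1, 2a) has c ≤ a + b, and then
--     √c ≤ √a + √b  (subadditivity of √);
--   * splitting F_c, F_c ↦ F_a, F_b (moves 2b, 2c) has a + b ≤ 2c, and then
--     √a + √b ≤ 2√c  (concavity of √, via AM–GM).
-- As S is additive over multisets, S does not increase under a move, so S
-- is non-increasing along every play.

open import Defs
open import Data.Nat using (ℕ)
open import Data.List using (List)
open import Data.Sum using (_⊎_)

open import Data.Nat as N using (zero; suc; z≤n; s≤s)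
import Data.Nat.Properties as Nₚ
open import Data.List using ([]; _∷_; _++_)
open import Data.List.Relation.Binary.Permutation.Propositional as ↭ using (_↭_)
open import Data.Product using (_,_)
open import Data.Sum using (inj₁; inj₂)
open import Relation.Nullary using (¬_)
open import Relation.Binary.Bundles using (Poset)
open import Relation.Binary.Structures using (IsTotalOrder)
import Relation.Binary.PropositionalEquality as PE
open import Algebra.Bundles using (CommutativeRing)

module PolynomialIdentities {c ℓ} (CR : CommutativeRing c ℓ) where
  open CommutativeRing CR
  open import Algebra.Solver.Ring.NaturalCoefficients.Default commutativeSemiring

  square-of-sum : ∀ u v → (u + v) * (u + v) ≈ (u * u + v * v) + (u * v + u * v)
  square-of-sum = solve 2 (λ u v → (u :+ v) :* (u :+ v) := (u :* u :+ v :* v) :+ (u :* v :+ u :* v)) refl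

  -- The expansion behind AM–GM, with m standing for - v and p for u * v.
  square-of-sum-shifted : ∀ u m p →
    (u + m) * (u + m) + (p + p) ≈ (u * u + m * m) + ((u * m + p) + (u * m + p))
  square-of-sum-shifted = solve 3 (λ u m p →
    (u :+ m) :* (u :+ m) :+ (p :+ p) := (u :* u :+ m :* m) :+ ((u :* m :+ p) :+ (u :* m :+ p))) refl

  -- The two halves of x + e s = y when (x + y) s = 1 and x² + e = y².
  regroupˡ : ∀ x y s e → x * ((x + y) * s) + e * s ≈ ((x * x + e) + x * y) * s
  regroupˡ = solve 4 (λ x y s e → x :* ((x :+ y) :* s) :+ e :* s := ((x :* x :+ e) :+ x :* y) :* s) refl

  regroupʳ : ∀ x y s → (y * y + x * y) * s ≈ y * ((x + y) * s)
  regroupʳ = solve 3 (λ x y s → (y :* y :+ x :* y) :* s := y :* ((x :+ y) :* s)) refl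

  swap-+ : ∀ x y z → x + (y + z) ≈ y + (x + z)
  swap-+ = solve 3 (λ x y z → x :+ (y :+ z) := y :+ (x :+ z)) refl

split-indices : ∀ k → suc k N.+ (4 N.+ k) N.≤ (3 N.+ k) N.+ (3 N.+ k)
split-indices k =
  Nₚ.≤-trans (Nₚ.≤-reflexive (PE.cong suc (Nₚ.+-suc k (3 N.+ k)))) (Nₚ.n≤1+n _)

module Monovariant {c ℓ₁ ℓ₂} (R : OrderedSqrtField c ℓ₁ ℓ₂) where
  open OrderedSqrtField R renaming (_≤_ to infix 4 _≤_)
  open IsTotalOrder isTotalOrder using (isPartialOrder; total; antisym) renaming (refl to ≤-refl)
  open PolynomialIdentities commutativeRing
  open import Algebra.Properties.Ring ring using (-‿distribˡ-*; -‿distribʳ-*; -‿involutive)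

  poset : Poset c ℓ₁ ℓ₂
  poset = record { isPartialOrder = isPartialOrder }

  open import Relation.Binary.Reasoning.PartialOrder poset

  +-monoˡ-≤ : ∀ z {x y} → x ≤ y → z + x ≤ z + y
  +-monoˡ-≤ z {x} {y} x≤y = begin
    z + x  ≈⟨ +-comm z x ⟩
    x + z  ≤⟨ +-monoʳ-≤ z x≤y ⟩
    y + z  ≈⟨ +-comm y z ⟩
    z + y  ∎

  +-mono-≤ : ∀ {a b x y} → a ≤ b → x ≤ y → a + x ≤ b + y
  +-mono-≤ {a} {b} {x} {y} a≤b x≤y = begin
    a + x  ≤⟨ +-monoʳ-≤ x a≤b ⟩
    b + x  ≤⟨ +-monoˡ-≤ b x≤y ⟩
    b + y  ∎

  +-nonneg : ∀ {a b} → 0# ≤ a → 0# ≤ b → 0# ≤ a + b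
  +-nonneg {a} {b} 0≤a 0≤b = begin
    0#       ≈⟨ +-identityʳ 0# ⟨
    0# + 0#  ≤⟨ +-mono-≤ 0≤a 0≤b ⟩
    a + b    ∎

  x≤x+d : ∀ {d} x → 0# ≤ d → x ≤ x + d
  x≤x+d {d} x 0≤d = begin
    x       ≈⟨ +-identityʳ x ⟨
    x + 0#  ≤⟨ +-monoˡ-≤ x 0≤d ⟩
    x + d   ∎

  +-nonzeroˡ : ∀ {u v} → 0# ≤ u → 0# ≤ v → ¬ (u ≈ 0#) → ¬ (u + v ≈ 0#)
  +-nonzeroˡ {u} {v} 0≤u 0≤v u≉0 u+v≈0 = u≉0 (antisym u≤0 0≤u)
    where
      u≤0 : u ≤ 0#
      u≤0 = begin u ≤⟨ x≤x+d u 0≤v ⟩ u + v ≈⟨ u+v≈0 ⟩ 0# ∎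

  +-nonzeroʳ : ∀ {u v} → 0# ≤ u → 0# ≤ v → ¬ (v ≈ 0#) → ¬ (u + v ≈ 0#)
  +-nonzeroʳ {u} {v} 0≤u 0≤v v≉0 u+v≈0 = +-nonzeroˡ 0≤v 0≤u v≉0 (trans (+-comm v u) u+v≈0)

  0≤-difference : ∀ {x y} → x ≤ y → 0# ≤ y - x
  0≤-difference {x} {y} x≤y = begin
    0#      ≈⟨ -‿inverseʳ x ⟨
    x - x   ≤⟨ +-monoʳ-≤ (- x) x≤y ⟩
    y - x   ∎

  +-difference : ∀ x y → x + (y - x) ≈ y
  +-difference x y = begin-equality
    x + (y - x)  ≈⟨ swap-+ x y (- x) ⟩
    y + (x - x)  ≈⟨ +-congˡ (-‿inverseʳ x) ⟩
    y + 0#       ≈⟨ +-identityʳ y ⟩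
    y            ∎

  -‿nonneg : ∀ {w} → w ≤ 0# → 0# ≤ - w
  -‿nonneg {w} w≤0 = begin
    0#      ≈⟨ -‿inverseʳ w ⟨
    w - w   ≤⟨ +-monoʳ-≤ (- w) w≤0 ⟩
    0# - w  ≈⟨ +-identityˡ (- w) ⟩
    - w     ∎

  -‿square : ∀ w → (- w) * (- w) ≈ w * w
  -‿square w = begin-equality
    (- w) * (- w)  ≈⟨ -‿distribˡ-* w (- w) ⟨
    - (w * - w)    ≈⟨ -‿cong (-‿distribʳ-* w w) ⟨
    - (- (w * w))  ≈⟨ -‿involutive (w * w) ⟩
    w * w          ∎

  square-nonneg : ∀ w → 0# ≤ w * w
  square-nonneg w with total 0# w
  ... | inj₁ 0≤w = *-nonneg 0≤w 0≤w
  ... | inj₂ w≤0 = begin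
    0#             ≤⟨ *-nonneg (-‿nonneg w≤0) (-‿nonneg w≤0) ⟩
    (- w) * (- w)  ≈⟨ -‿square w ⟩
    w * w          ∎

  0≤1 : 0# ≤ 1#
  0≤1 = begin 0# ≤⟨ square-nonneg 1# ⟩ 1# * 1# ≈⟨ *-identityˡ 1# ⟩ 1# ∎

  -- The inverse of a nonnegative element is nonnegative: w = z w².
  inverse-nonneg : ∀ {z w} → 0# ≤ z → z * w ≈ 1# → 0# ≤ w
  inverse-nonneg {z} {w} 0≤z zw≈1 = begin
    0#           ≤⟨ *-nonneg 0≤z (square-nonneg w) ⟩
    z * (w * w)  ≈⟨ *-assoc z w w ⟨
    (z * w) * w  ≈⟨ *-congʳ zw≈1 ⟩
    1# * w       ≈⟨ *-identityˡ w ⟩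
    w            ∎

  -- Squares of nonnegatives compare like the numbers themselves:
  -- with s = (x + y)⁻¹ and e = y² - x² ≥ 0 we have y = x + e s ≥ x.
  square-≤-cancel : ∀ {x y} → 0# ≤ x → 0# ≤ y → ¬ (x + y ≈ 0#) → x * x ≤ y * y → x ≤ y
  square-≤-cancel {x} {y} 0≤x 0≤y x+y≉0 x²≤y² with inverse (x + y) x+y≉0
  ... | s , [x+y]s≈1 = begin
    x                          ≤⟨ x≤x+d x (*-nonneg (0≤-difference x²≤y²) 0≤s) ⟩
    x + e * s                  ≈⟨ +-congʳ (trans (*-congˡ [x+y]s≈1) (*-identityʳ x)) ⟨
    x * ((x + y) * s) + e * s  ≈⟨ regroupˡ x y s e ⟩
    ((x * x + e) + x * y) * s  ≈⟨ *-congʳ (+-congʳ (+-difference (x * x) (y * y))) ⟩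
    (y * y + x * y) * s        ≈⟨ regroupʳ x y s ⟩
    y * ((x + y) * s)          ≈⟨ *-congˡ [x+y]s≈1 ⟩
    y * 1#                     ≈⟨ *-identityʳ y ⟩
    y                          ∎
    where
      e = y * y - x * x
      0≤s : 0# ≤ s
      0≤s = inverse-nonneg (+-nonneg 0≤x 0≤y) [x+y]s≈1

  -- AM–GM: 2uv ≤ u² + v², since (u - v)² ≥ 0.
  am-gm : ∀ u v → u * v + u * v ≤ u * u + v * v
  am-gm u v = begin
    p + p                                    ≈⟨ +-identityˡ (p + p) ⟨
    0# + (p + p)                             ≤⟨ +-monoʳ-≤ (p + p) (square-nonneg (u - v)) ⟩
    (u - v) * (u - v) + (p + p)              ≈⟨ square-of-sum-shifted u (- v) p ⟩
    (u * u + (- v) * (- v)) + (q + q)        ≈⟨ +-cong (+-congˡ (-‿square v)) (+-cong q≈0 q≈0) ⟩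
    (u * u + v * v) + (0# + 0#)              ≈⟨ +-congˡ (+-identityʳ 0#) ⟩
    (u * u + v * v) + 0#                     ≈⟨ +-identityʳ _ ⟩
    u * u + v * v                            ∎
    where
      p = u * v
      q = u * - v + p
      q≈0 : q ≈ 0#
      q≈0 = trans (+-congʳ (sym (-‿distribʳ-* u v))) (-‿inverseˡ p)

  √-nonzero : ∀ {a} → 0# ≤ a → ¬ (a ≈ 0#) → ¬ (√ a ≈ 0#)
  √-nonzero {a} 0≤a a≉0 √a≈0 = a≉0 (begin-equality
    a          ≈⟨ √-square 0≤a ⟨
    √ a * √ a  ≈⟨ *-cong √a≈0 √a≈0 ⟩
    0# * 0#    ≈⟨ zeroˡ 0# ⟩
    0#         ∎)

  square-of-√-sum : ∀ {a b} → 0# ≤ a → 0# ≤ b →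
    (√ a + √ b) * (√ a + √ b) ≈ (a + b) + (√ a * √ b + √ a * √ b)
  square-of-√-sum {a} {b} 0≤a 0≤b =
    trans (square-of-sum (√ a) (√ b)) (+-congʳ (+-cong (√-square 0≤a) (√-square 0≤b)))

  -- Subadditivity: c ≤ a + b implies √c ≤ √a + √b (a ≠ 0 makes √a + √b
  -- nonzero, as square-≤-cancel requires).
  √-≤-+ : ∀ {a b c} → 0# ≤ a → 0# ≤ b → 0# ≤ c → ¬ (a ≈ 0#) →
    c ≤ a + b → √ c ≤ √ a + √ b
  √-≤-+ {a} {b} {c} 0≤a 0≤b 0≤c a≉0 c≤a+b =
    square-≤-cancel 0≤√c 0≤√a+√b
      (+-nonzeroʳ 0≤√c 0≤√a+√b (+-nonzeroˡ 0≤√a 0≤√b (√-nonzero 0≤a a≉0))) (begin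
        √ c * √ c                          ≈⟨ √-square 0≤c ⟩
        c                                  ≤⟨ c≤a+b ⟩
        a + b                              ≤⟨ x≤x+d (a + b) (+-nonneg 0≤√a√b 0≤√a√b) ⟩
        (a + b) + (√ a * √ b + √ a * √ b)  ≈⟨ square-of-√-sum 0≤a 0≤b ⟨
        (√ a + √ b) * (√ a + √ b)          ∎)
    where
      0≤√a = √-nonneg 0≤a
      0≤√b = √-nonneg 0≤b
      0≤√c = √-nonneg 0≤c
      0≤√a+√b = +-nonneg 0≤√a 0≤√b
      0≤√a√b = *-nonneg 0≤√a 0≤√b

  √-+-≤-double : ∀ {a b c} → 0# ≤ a → 0# ≤ b → 0# ≤ c → ¬ (a ≈ 0#) →
    a + b ≤ c + c → √ a + √ b ≤ √ c + √ c
  √-+-≤-double {a} {b} {c} 0≤a 0≤b 0≤c a≉0 a+b≤2c =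
    square-≤-cancel 0≤√a+√b 0≤√c+√c
      (+-nonzeroˡ 0≤√a+√b 0≤√c+√c (+-nonzeroˡ 0≤√a 0≤√b (√-nonzero 0≤a a≉0))) (begin
        (√ a + √ b) * (√ a + √ b)          ≈⟨ square-of-√-sum 0≤a 0≤b ⟩
        (a + b) + (√ a * √ b + √ a * √ b)  ≤⟨ +-monoˡ-≤ (a + b) (am-gm (√ a) (√ b)) ⟩
        (a + b) + (√ a * √ a + √ b * √ b)  ≈⟨ +-congˡ (+-cong (√-square 0≤a) (√-square 0≤b)) ⟩
        (a + b) + (a + b)                  ≤⟨ +-mono-≤ a+b≤2c a+b≤2c ⟩
        (c + c) + (c + c)                  ≈⟨ +-congˡ (+-cong (√-square 0≤c) (√-square 0≤c)) ⟨
        (c + c) + (√ c * √ c + √ c * √ c)  ≈⟨ square-of-√-sum 0≤c 0≤c ⟨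
        (√ c + √ c) * (√ c + √ c)          ∎)
    where
      0≤√a = √-nonneg 0≤a
      0≤√b = √-nonneg 0≤b
      0≤√a+√b = +-nonneg 0≤√a 0≤√b
      0≤√c+√c = +-nonneg (√-nonneg 0≤c) (√-nonneg 0≤c)

  ι-nonneg : ∀ n → 0# ≤ ι R n
  ι-nonneg zero    = ≤-refl
  ι-nonneg (suc n) = +-nonneg 0≤1 (ι-nonneg n)

  ι-+ : ∀ m n → ι R (m N.+ n) ≈ ι R m + ι R n
  ι-+ zero    n = sym (+-identityˡ (ι R n))
  ι-+ (suc m) n = trans (+-congˡ (ι-+ m n)) (sym (+-assoc 1# (ι R m) (ι R n)))

  ι-mono : ∀ {m n} → m N.≤ n → ι R m ≤ ι R n
  ι-mono {n = n} z≤n = ι-nonneg n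
  ι-mono (s≤s m≤n)   = +-monoˡ-≤ 1# (ι-mono m≤n)

  ι-suc-nonzero : ∀ n → ¬ (ι R (suc n) ≈ 0#)
  ι-suc-nonzero n = +-nonzeroˡ 0≤1 (ι-nonneg n) (λ 1≈0 → 0≉1 (sym 1≈0))

  ι-≤-+ : ∀ a b {c} → c N.≤ a N.+ b → ι R c ≤ ι R a + ι R b
  ι-≤-+ a b {c} c≤a+b = begin
    ι R c            ≤⟨ ι-mono c≤a+b ⟩
    ι R (a N.+ b)    ≈⟨ ι-+ a b ⟩
    ι R a + ι R b    ∎

  S-++ : ∀ xs ys → S R (xs ++ ys) ≈ S R xs + S R ys
  S-++ []       ys = sym (+-identityˡ (S R ys))
  S-++ (x ∷ xs) ys = trans (+-congˡ (S-++ xs ys)) (sym (+-assoc _ (S R xs) (S R ys)))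

  S-↭ : ∀ {xs ys} → xs ↭ ys → S R xs ≈ S R ys
  S-↭ ↭.refl         = refl
  S-↭ (↭.prep x p)   = +-congˡ (S-↭ p)
  S-↭ (↭.swap x y p) = trans (+-congˡ (+-congˡ (S-↭ p))) (swap-+ _ _ _)
  S-↭ (↭.trans p q)  = trans (S-↭ p) (S-↭ q)

  S-singleton : ∀ a → S R (a ∷ []) ≈ √ (ι R a)
  S-singleton a = +-identityʳ (√ (ι R a))

  S-pair : ∀ a b → S R (a ∷ b ∷ []) ≈ √ (ι R a) + √ (ι R b)
  S-pair a b = +-congˡ (+-identityʳ (√ (ι R b)))

  S-merge : ∀ a b c → c N.≤ suc a N.+ b → S R (c ∷ []) ≤ S R (suc a ∷ b ∷ [])
  S-merge a b c c≤a+b = begin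
    S R (c ∷ [])                  ≈⟨ S-singleton c ⟩
    √ (ι R c)                     ≤⟨ √-≤-+ (ι-nonneg (suc a)) (ι-nonneg b) (ι-nonneg c)
                                           (ι-suc-nonzero a) (ι-≤-+ (suc a) b c≤a+b) ⟩
    √ (ι R (suc a)) + √ (ι R b)   ≈⟨ S-pair (suc a) b ⟨
    S R (suc a ∷ b ∷ [])          ∎

  S-split : ∀ a b c → suc a N.+ b N.≤ c N.+ c → S R (suc a ∷ b ∷ []) ≤ S R (c ∷ c ∷ [])
  S-split a b c a+b≤2c = begin
    S R (suc a ∷ b ∷ [])          ≈⟨ S-pair (suc a) b ⟩
    √ (ι R (suc a)) + √ (ι R b)   ≤⟨ √-+-≤-double (ι-nonneg (suc a)) (ι-nonneg b) (ι-nonneg c)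
                                           (ι-suc-nonzero a) a+b≤2c′ ⟩
    √ (ι R c) + √ (ι R c)         ≈⟨ S-pair c c ⟨
    S R (c ∷ c ∷ [])              ∎
    where
      a+b≤2c′ : ι R (suc a) + ι R b ≤ ι R c + ι R c
      a+b≤2c′ = begin
        ι R (suc a) + ι R b     ≈⟨ ι-+ (suc a) b ⟨
        ι R (suc a N.+ b)       ≤⟨ ι-≤-+ c c a+b≤2c ⟩
        ι R c + ι R c           ∎

  local-move-decreases : ∀ {old new} → LocalMove old new → S R new ≤ S R old
  local-move-decreases (combine k) = S-merge k (2 N.+ k) (3 N.+ k) (s≤s (Nₚ.m≤n+m (2 N.+ k) k))
  local-move-decreases ones        = S-merge 0 1 2 Nₚ.≤-refl
  local-move-decreases twos        = S-split 0 3 2 Nₚ.≤-refl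
  local-move-decreases (split k)   = S-split k (4 N.+ k) (3 N.+ k) (split-indices k)

  move-decreases : ∀ {xs ys} → Move xs ys → S R ys ≤ S R xs
  move-decreases {xs} {ys} (move old new rest local xs≈old++rest ys≈new++rest) = begin
    S R ys                ≈⟨ trans (S-↭ ys≈new++rest) (S-++ new rest) ⟩
    S R new + S R rest    ≤⟨ +-monoʳ-≤ (S R rest) (local-move-decreases local) ⟩
    S R old + S R rest    ≈⟨ trans (S-↭ xs≈old++rest) (S-++ old rest) ⟨
    S R xs                ∎

lemma2p1 : ∀ {c ℓ₁ ℓ₂} (R : OrderedSqrtField c ℓ₁ ℓ₂) (n len : ℕ) (st : ℕ → List ℕ) →
    Play n len st →
    NonIncreasing R len st ⊎ NonDecreasing R len st
lemma2p1 R n len st play =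
  inj₁ (λ i i<len → Monovariant.move-decreases R (Play.legal play i i<len))
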